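{- Let $S\subseteq2^E$ and $e\in E$. Then $S$ is powerful if and only if its parallel extension $S^{\parallel e}$ (formed by duplicating the column indexed by $e$ in the matrix representation of $S$) is powerful.
   Context: A set $S\subseteq\{0,1\}^E$ (equivalently $S\subseteq2^E$, identifying subsets with characteristic vectors) is powerful if for every $X\subseteq E$ the number of vectors in $S$ that are zero in all positions indexed by $X$ is a power of 2. The matrix representation of $S$ has the members of $S$ as rows and columns indexed by $E$. For $e\in E$, the parallel extension $S^{\parallel e}$ is the set obtained by adding a new element whose column is a copy of the column indexed by $e$. -}

module Defs where

open import Data.Nat using (ℕ; zero; suc; _+_; _^_)
open import Data.Bool using (Bool; true; false; _∧_; not; if_then_else_)
open import Data.Bool.Properties using () renaming (_≟_ to _≟ᵇ_)
open import Data.Vec using (Vec; []; _∷_; lookup)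
open import Data.Fin using (Fin)
open import Data.List using (List; [_]; map; _++_)
open import Data.Product using (∃)
open import Relation.Binary.PropositionalEquality using (_≡_)
open import Relation.Nullary.Decidable using (⌊_⌋)

-- A ground set E = Fin n.  A subset of E is its characteristic vector in {0,1}^E,
-- i.e. a Vec Bool n.  A set S ⊆ {0,1}^E is given by its (decidable)
-- membership function.
BVec : ℕ → Set
BVec n = Vec Bool n

Family : ℕ → Set
Family n = BVec n → Bool

allVecs : (n : ℕ) → List (BVec n)
allVecs zero = [ [] ]
allVecs (suc n) = map (true ∷_) (allVecs n) ++ map (false ∷_) (allVecs n)

zeroOn : ∀ {n} → BVec n → BVec n → Bool
zeroOn [] [] = true
zeroOn (x ∷ X) (b ∷ v) = not (x ∧ b) ∧ zeroOn X v

countL : ∀ {n} → (BVec n → Bool) → List (BVec n) → ℕ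
countL p List.[] = 0
countL p (v List.∷ vs) = (if p v then 1 else 0) + countL p vs

countZero : ∀ {n} → Family n → BVec n → ℕ
countZero {n} S X = countL (λ v → S v ∧ zeroOn X v) (allVecs n)

IsPowerOf2 : ℕ → Set
IsPowerOf2 m = ∃ λ k → m ≡ 2 ^ k

Powerful : ∀ {n} → Family n → Set
Powerful {n} S = (X : BVec n) → IsPowerOf2 (countZero S X)

-- Parallel extension: new element placed as coordinate 0 of Fin (suc n),
-- old element i becomes suc i.  Rows are (v_e ∷ v) for v ∈ S.
parallelExt : ∀ {n} → Family n → Fin n → Family (suc n)
parallelExt S e (b ∷ v) = S v ∧ ⌊ b ≟ᵇ lookup v e ⌋

-- Every row v of S gives the two candidate rows (true ∷ v) and (false ∷ v) of
-- S^∥e, of which exactly the one with first entry v_e is present.  Hence the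
-- rows of S^∥e avoiding (x ∷ X) correspond to the rows of S avoiding X, with e
-- added to X when x is set; every zero count of S^∥e is a zero count of S, and
-- conversely every X arises (as false ∷ X).

module Submission where

open import Defs
open import Data.Nat using (ℕ; suc; _+_)
open import Data.Nat.Properties using (+-assoc; +-identityʳ; +-commutativeSemigroup)
open import Data.Bool using (Bool; true; false; _∧_; not; if_then_else_)
open import Data.Bool.Properties using (∧-commutativeMonoid) renaming (_≟_ to _≟ᵇ_)
open import Data.Fin using (Fin; zero; suc)
open import Data.Vec using (_∷_; lookup; _[_]≔_)
open import Data.List using (List; map; _++_)
open import Data.Product using (_×_; _,_)
open import Function using (_∘_)
open import Relation.Binary.PropositionalEquality using (_≡_; refl; cong; cong₂; subst; sym; trans; module ≡-Reasoning)
open import Relation.Nullary.Decidable using (⌊_⌋)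
open import Algebra.Bundles using (CommutativeMonoid)
import Algebra.Properties.CommutativeSemigroup as CommSemigroupProperties

open CommSemigroupProperties +-commutativeSemigroup using (interchange)
open CommSemigroupProperties (CommutativeMonoid.commutativeSemigroup ∧-commutativeMonoid)
  using (x∙yz≈y∙xz)

ind : Bool → ℕ
ind b = if b then 1 else 0

countL-++ : ∀ {n} (p : BVec n → Bool) (A B : List (BVec n)) →
  countL p (A ++ B) ≡ countL p A + countL p B
countL-++ p List.[] B = refl
countL-++ p (v List.∷ A) B =
  trans (cong (ind (p v) +_) (countL-++ p A B)) (sym (+-assoc (ind (p v)) _ _))

countL-map : ∀ {m n} (p : BVec n → Bool) (f : BVec m → BVec n) (A : List (BVec m)) →
  countL p (map f A) ≡ countL (p ∘ f) A
countL-map p f List.[] = refl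
countL-map p f (v List.∷ A) = cong (ind (p (f v)) +_) (countL-map p f A)

countL-+ : ∀ {n} (p q r : BVec n → Bool) (A : List (BVec n)) →
  (∀ v → ind (p v) + ind (q v) ≡ ind (r v)) → countL p A + countL q A ≡ countL r A
countL-+ p q r List.[] h = refl
countL-+ p q r (v List.∷ A) h =
  trans (interchange (ind (p v)) (countL p A) (ind (q v)) (countL q A))
        (cong₂ _+_ (h v) (countL-+ p q r A h))

addIf : ∀ {n} → Bool → Fin n → BVec n → BVec n
addIf true  e X = X [ e ]≔ true
addIf false e X = X

zeroOn-≔true : ∀ {n} (X v : BVec n) (e : Fin n) →
  zeroOn (X [ e ]≔ true) v ≡ not (lookup v e) ∧ zeroOn X v
zeroOn-≔true (y ∷ X) (true ∷ v) zero = refl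
zeroOn-≔true (true ∷ X) (false ∷ v) zero = refl
zeroOn-≔true (false ∷ X) (false ∷ v) zero = refl
zeroOn-≔true (y ∷ X) (b ∷ v) (suc e) = begin
  not (y ∧ b) ∧ zeroOn (X [ e ]≔ true) v           ≡⟨ cong (not (y ∧ b) ∧_) (zeroOn-≔true X v e) ⟩
  not (y ∧ b) ∧ (not (lookup v e) ∧ zeroOn X v)    ≡⟨ x∙yz≈y∙xz (not (y ∧ b)) (not (lookup v e)) (zeroOn X v) ⟩
  not (lookup v e) ∧ (not (y ∧ b) ∧ zeroOn X v)    ∎
  where open ≡-Reasoning

zeroOn-addIf : ∀ {n} (x : Bool) (e : Fin n) (X v : BVec n) →
  zeroOn (addIf x e X) v ≡ not (x ∧ lookup v e) ∧ zeroOn X v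
zeroOn-addIf true  e X v = zeroOn-≔true X v e
zeroOn-addIf false e X v = refl

ind-parallel-rows : ∀ s b x z →
  ind ((s ∧ ⌊ true ≟ᵇ b ⌋) ∧ (not (x ∧ true) ∧ z)) + ind ((s ∧ ⌊ false ≟ᵇ b ⌋) ∧ (not (x ∧ false) ∧ z))
    ≡ ind (s ∧ (not (x ∧ b) ∧ z))
ind-parallel-rows false b     x z = refl
ind-parallel-rows true  true  x z = +-identityʳ _
ind-parallel-rows true  false x z = refl

countZero-parallelExt : ∀ {n} (S : Family n) (e : Fin n) (x : Bool) (X : BVec n) →
  countZero (parallelExt S e) (x ∷ X) ≡ countZero S (addIf x e X)
countZero-parallelExt {n} S e x X = begin
  countL P (map (true ∷_) A ++ map (false ∷_) A)           ≡⟨ countL-++ P (map (true ∷_) A) (map (false ∷_) A) ⟩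
  countL P (map (true ∷_) A) + countL P (map (false ∷_) A) ≡⟨ cong₂ _+_ (countL-map P (true ∷_) A) (countL-map P (false ∷_) A) ⟩
  countL (P ∘ (true ∷_)) A + countL (P ∘ (false ∷_)) A     ≡⟨ countL-+ _ _ _ A rows ⟩
  countZero S (addIf x e X)                                ∎
  where
  open ≡-Reasoning
  A = allVecs n
  P : BVec (suc n) → Bool
  P w = parallelExt S e w ∧ zeroOn (x ∷ X) w
  rows : ∀ v → ind (P (true ∷ v)) + ind (P (false ∷ v)) ≡ ind (S v ∧ zeroOn (addIf x e X) v)
  rows v = trans (ind-parallel-rows (S v) (lookup v e) x (zeroOn X v))
                 (cong (ind ∘ (S v ∧_)) (sym (zeroOn-addIf x e X v)))

theorem7 : (n : ℕ) (S : Family n) (e : Fin n) →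
    (Powerful S → Powerful (parallelExt S e)) × (Powerful (parallelExt S e) → Powerful S)
theorem7 n S e = extend , restrict
  where
  extend : Powerful S → Powerful (parallelExt S e)
  extend h (x ∷ X) = subst IsPowerOf2 (sym (countZero-parallelExt S e x X)) (h (addIf x e X))
  restrict : Powerful (parallelExt S e) → Powerful S
  restrict h X = subst IsPowerOf2 (countZero-parallelExt S e false X) (h (false ∷ X))
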